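{- Let $(P,\leq,\cdot)$ be a right posemigroup and $x,y\in P$. If $x\cdot y=y$, then $(y\cdot x){\downarrow}$ is isomorphic to $y{\downarrow}$.
   Context: A right posemigroup is a structure $(P,\leq,\cdot)$ where $(P,\leq)$ is a poset and $\cdot$ is a right-regular band operation on $P$ (associative, with $x\cdot x=x$ and $x\cdot y\cdot x=y\cdot x$) such that for all $x,y$: $x\leq y\iff x\cdot y=x$. For $z\in P$, $z{\downarrow}=\{a\in P: a\leq z\}$; such down-sets are closed under $\cdot$, and isomorphism means a bijection preserving $\cdot$ (equivalently preserving the order, since the order is determined by $\cdot$). -}

module Defs where

open import Level using (Level; _⊔_; suc)
open import Data.Product using (Σ; _,_; proj₁; ∃; _×_)
open import Relation.Binary.PropositionalEquality using (_≡_)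
open import Relation.Binary.Structures using (IsPartialOrder)
open import Function.Definitions using (Bijective)

record RightPosemigroup (c ℓ : Level) : Set (Level.suc (c ⊔ ℓ)) where
  infixl 7 _·_
  infix 4 _≤_
  field
    Carrier   : Set c
    _≤_       : Carrier → Carrier → Set ℓ
    _·_       : Carrier → Carrier → Carrier
    isPartialOrder : IsPartialOrder _≡_ _≤_
    assoc     : ∀ x y z → (x · y) · z ≡ x · (y · z)
    idem      : ∀ x → x · x ≡ x
    rightReg  : ∀ x y → x · y · x ≡ y · x
    ≤⇒·       : ∀ {x y} → x ≤ y → x · y ≡ x
    ·⇒≤       : ∀ {x y} → x · y ≡ x → x ≤ y

  ↓_ : Carrier → Set (c ⊔ ℓ)
  ↓ z = Σ Carrier (λ a → a ≤ z)

  -- down-sets are closed under ·  (as a function into the carrier)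
  -- isomorphism of z↓ and w↓: a bijection f between them with
  -- proj₁ (f (a · b)) = proj₁ (f a) · proj₁ (f b), stated on underlying elements.
  DownIso : Carrier → Carrier → Set (c ⊔ ℓ)
  DownIso z w =
    ∃ λ (f : ↓ z → ↓ w) →
      Bijective (λ a b → proj₁ a ≡ proj₁ b) (λ a b → proj₁ a ≡ proj₁ b) f
      × (∀ (a b : ↓ z) (ab : ↓ z) → proj₁ ab ≡ proj₁ a · proj₁ b →
           proj₁ (f ab) ≡ proj₁ (f a) · proj₁ (f b))

{-# OPTIONS --safe #-}
module Submission where

-- Right translation a ↦ a · y maps (y · x)↓ into y↓, and right translation by x
-- maps y↓ back into (y · x)↓.  Since a ≤ y · x means a · y · x = a, and
-- b ≤ y together with x · y = y gives b · x · y = b, the two maps are mutually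
-- inverse.  Every right translation of a right-regular band is an endomorphism:
-- a · b · c = a · (c · b · c) = (a · c) · (b · c).

open import Defs
open import Level using (Level)
open import Relation.Binary.Core using (Rel)
open import Relation.Binary.PropositionalEquality using (_≡_; sym; trans; cong; module ≡-Reasoning)
open import Function.Base using (_on_)
open import Function.Definitions using (Injective; Surjective)
open import Data.Product using (_,_; proj₁)

module RightPosemigroupProperties {c ℓ : Level} (P : RightPosemigroup c ℓ) where

  open RightPosemigroup P
  open ≡-Reasoning

  x·y≤y : ∀ a b → a · b ≤ b
  x·y≤y a b = ·⇒≤ (begin
    a · b · b   ≡⟨ assoc a b b ⟩
    a · (b · b) ≡⟨ cong (a ·_) (idem b) ⟩
    a · b       ∎)

  ·-monoˡ-≤ : ∀ {a b} c → a ≤ b → a · c ≤ b · c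
  ·-monoˡ-≤ {a} {b} c a≤b = ·⇒≤ (begin
    a · c · (b · c)   ≡⟨ assoc a c (b · c) ⟩
    a · (c · (b · c)) ≡⟨ cong (a ·_) (sym (assoc c b c)) ⟩
    a · (c · b · c)   ≡⟨ cong (a ·_) (rightReg c b) ⟩
    a · (b · c)       ≡⟨ sym (assoc a b c) ⟩
    a · b · c         ≡⟨ cong (_· c) (≤⇒· a≤b) ⟩
    a · c             ∎)

  ·-distribʳ : ∀ a b c → a · b · c ≡ (a · c) · (b · c)
  ·-distribʳ a b c = begin
    a · b · c         ≡⟨ assoc a b c ⟩
    a · (b · c)       ≡⟨ cong (a ·_) (sym (rightReg c b)) ⟩
    a · (c · b · c)   ≡⟨ cong (a ·_) (assoc c b c) ⟩
    a · (c · (b · c)) ≡⟨ sym (assoc a c (b · c)) ⟩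
    a · c · (b · c)   ∎

  ≈↓ : ∀ z → Rel (↓ z) c
  ≈↓ z = _≡_ on proj₁

  ρ↓ : ∀ {z} w → ↓ z → ↓ w
  ρ↓ w (a , _) = a · w , x·y≤y a w

  ρ↓· : ∀ {w} d → ↓ w → ↓ (w · d)
  ρ↓· d (b , b≤w) = b · d , ·-monoˡ-≤ d b≤w

  ρ↓-homomorphic : ∀ {z} w (a b ab : ↓ z) → proj₁ ab ≡ proj₁ a · proj₁ b →
                   proj₁ (ρ↓ w ab) ≡ proj₁ (ρ↓ w a) · proj₁ (ρ↓ w b)
  ρ↓-homomorphic w (a , _) (b , _) (ab , _) ab≡a·b =
    trans (cong (_· w) ab≡a·b) (·-distribʳ a b w)

  ρ↓·∘ρ↓≗id : ∀ {w} d (a : ↓ (w · d)) → proj₁ (ρ↓· d (ρ↓ w a)) ≡ proj₁ a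
  ρ↓·∘ρ↓≗id {w} d (a , a≤w·d) = trans (assoc a w d) (≤⇒· a≤w·d)

  ρ↓∘ρ↓·≗id : ∀ {w d} → d · w ≡ w → (b : ↓ w) → proj₁ (ρ↓ w (ρ↓· d b)) ≡ proj₁ b
  ρ↓∘ρ↓·≗id {w} {d} d·w≡w (b , b≤w) = begin
    b · d · w   ≡⟨ assoc b d w ⟩
    b · (d · w) ≡⟨ cong (b ·_) d·w≡w ⟩
    b · w       ≡⟨ ≤⇒· b≤w ⟩
    b           ∎

  ρ↓-injective : ∀ {w} d → Injective (≈↓ (w · d)) (≈↓ w) (ρ↓ w)
  ρ↓-injective d {a} {b} a·w≡b·w = begin
    proj₁ a                   ≡⟨ sym (ρ↓·∘ρ↓≗id d a) ⟩
    proj₁ (ρ↓· d (ρ↓ _ a))    ≡⟨ cong (_· d) a·w≡b·w ⟩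
    proj₁ (ρ↓· d (ρ↓ _ b))    ≡⟨ ρ↓·∘ρ↓≗id d b ⟩
    proj₁ b                   ∎

  ρ↓-surjective : ∀ {w d} → d · w ≡ w → Surjective (≈↓ (w · d)) (≈↓ w) (ρ↓ w)
  ρ↓-surjective {w} {d} d·w≡w b =
    ρ↓· d b , λ a≡b·d → trans (cong (_· w) a≡b·d) (ρ↓∘ρ↓·≗id d·w≡w b)

  ↓·-iso : ∀ {w d} → d · w ≡ w → DownIso (w · d) w
  ↓·-iso {w} {d} d·w≡w =
    -- ≈↓ forgets the order proof, so the implicit arguments of Injective are not inferable.
    ρ↓ w , ((λ {a b} → ρ↓-injective d {a} {b}) , ρ↓-surjective d·w≡w) , ρ↓-homomorphic w

lemma2p6 : ∀ {c ℓ} (P : RightPosemigroup c ℓ) (x y : RightPosemigroup.Carrier P) →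
    RightPosemigroup._·_ P x y ≡ y →
    RightPosemigroup.DownIso P (RightPosemigroup._·_ P y x) y
lemma2p6 P x y x·y≡y = RightPosemigroupProperties.↓·-iso P x·y≡y
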